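{- If $n\ge 7$ is odd, then every 3-connected bicubic planar map on $2n$ vertices has at least four distinct rootings.
   Context: A bicubic planar map is a 2-cell embedding in the sphere of a connected 3-regular bipartite graph. A rooting of a map is a choice of a directed edge (root edge); two rootings are considered the same if an orientation-preserving automorphism of the map carries one to the other. -}

module Defs where

open import Data.Nat using (ℕ; zero; suc; _+_; _*_; _≤ᵇ_; _≤_; _%_)
open import Data.Fin using (Fin; toℕ) renaming (zero to f0; suc to fs)
open import Data.Product using (Σ; ∃; ∃-syntax; _×_; _,_; proj₁; proj₂)
open import Data.List using (List; length; filter; cartesianProduct; allFin; upTo)
open import Data.Bool.ListAction using (all)
open import Data.Bool using (Bool; true; false; T)
open import Relation.Binary.PropositionalEquality using (_≡_; _≢_)
open import Relation.Nullary using (¬_)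
open import Relation.Nullary.Decidable using (does)
open import Data.Bool.Properties using (T?)
open import Data.Unit using (⊤)

-- A cubic map on V vertices is presented with vertex set Fin V and
-- dart (= directed edge / half-edge) set Fin V × Fin 3: dart (v , i) is the
-- i-th half-edge at vertex v, the half-edges at v being listed in the
-- cyclic (counterclockwise) order of the embedding.  So the vertex
-- rotation σ is fixed: σ (v , i) = (v , i+1 mod 3).  A map is then
-- determined by the edge involution α, a fixed-point-free involution on
-- darts.  Every cubic map is isomorphic to one of this form.

Vertex : ℕ → Set
Vertex V = Fin V

Dart : ℕ → Set
Dart V = Fin V × Fin 3

rot3 : Fin 3 → Fin 3
rot3 f0 = fs f0
rot3 (fs f0) = fs (fs f0)
rot3 (fs (fs f0)) = f0

σ : ∀ {V} → Dart V → Dart V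
σ (v , i) = (v , rot3 i)

record CubicMap (V : ℕ) : Set where
  field
    α        : Dart V → Dart V
    α-invol  : ∀ d → α (α d) ≡ d
    α-nofix  : ∀ d → α d ≢ d
open CubicMap public

-- face permutation φ = σ ∘ α; faces are its orbits
φ : ∀ {V} → CubicMap V → Dart V → Dart V
φ M d = σ (α M d)

iter : ∀ {A : Set} → (A → A) → ℕ → A → A
iter f zero x = x
iter f (suc k) x = f (iter f k x)

dartIndex : ∀ {V} → Dart V → ℕ
dartIndex (v , i) = 3 * toℕ v + toℕ i

allDarts : ∀ V → List (Dart V)
allDarts V = cartesianProduct (allFin V) (allFin 3)

-- d is the representative (least index) of its orbit under f
-- (orbits of a permutation of the 3V darts have length ≤ 3V)
isOrbitRep : ∀ {V} → (Dart V → Dart V) → Dart V → Bool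
isOrbitRep {V} f d = all (λ k → dartIndex d ≤ᵇ dartIndex (iter f k d)) (upTo (3 * V))

numOrbits : ∀ {V} → (Dart V → Dart V) → ℕ
numOrbits {V} f = length (filter (λ d → T? (isOrbitRep f d)) (allDarts V))

numFaces : ∀ {V} → CubicMap V → ℕ
numFaces M = numOrbits (φ M)

Adjacent : ∀ {V} → CubicMap V → Vertex V → Vertex V → Set
Adjacent M u w = ∃[ i ] ∃[ j ] (α M (u , i) ≡ (w , j))

data Reach {V} (M : CubicMap V) (P : Vertex V → Set) : Vertex V → Vertex V → Set where
  here : ∀ {u} → P u → Reach M P u u
  step : ∀ {u v w} → P u → Adjacent M u v → Reach M P v w → Reach M P u w

Connected : ∀ {V} → CubicMap V → Set
Connected {V} M = ∀ (u w : Vertex V) → Reach M (λ _ → ⊤) u w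

-- removing any two (possibly equal) vertices leaves the graph connected
-- Standard definition: more than 3 vertices and no separating set of size ≤ 2.
ThreeConnected : ∀ {V} → CubicMap V → Set
ThreeConnected {V} M =
  (4 ≤ V) × Connected M ×
  (∀ (a b u w : Vertex V) → u ≢ a → u ≢ b → w ≢ a → w ≢ b →
     Reach M (λ x → (x ≢ a) × (x ≢ b)) u w)

Bipartite : ∀ {V} → CubicMap V → Set
Bipartite {V} M = Σ (Vertex V → Bool) λ c → (∀ (u w : Vertex V) → Adjacent M u w → c u ≢ c w)

-- planar = genus 0: Euler formula V − E + F = 2 (map is connected), E = 3V/2
Planar : ∀ {V} → CubicMap V → Set
Planar {V} M = 2 * V + 2 * numFaces M ≡ 3 * V + 4

record Automorphism {V} (M : CubicMap V) : Set where
  field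
    g      : Dart V → Dart V
    g⁻¹    : Dart V → Dart V
    inv₁   : ∀ d → g (g⁻¹ d) ≡ d
    inv₂   : ∀ d → g⁻¹ (g d) ≡ d
    comm-σ : ∀ d → g (σ d) ≡ σ (g d)
    comm-α : ∀ d → g (α M d) ≡ α M (g d)

SameRooting : ∀ {V} → CubicMap V → Dart V → Dart V → Set
SameRooting M d e = Σ (Automorphism M) λ A → Automorphism.g A d ≡ e

AtLeastFourRootings : ∀ {V} → CubicMap V → Set
AtLeastFourRootings M =
  ∃[ d₀ ] ∃[ d₁ ] ∃[ d₂ ] ∃[ d₃ ]
    ( ¬ SameRooting M d₀ d₁ × ¬ SameRooting M d₀ d₂ × ¬ SameRooting M d₀ d₃
    × ¬ SameRooting M d₁ d₂ × ¬ SameRooting M d₁ d₃ × ¬ SameRooting M d₂ d₃ )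

module Submission where

-- A rooting is a dart d, and the lengths of the three faces met around its vertex, read off
-- starting at d, are preserved by orientation-preserving automorphisms; so it suffices to find
-- four darts whose face types are pairwise different.  If some vertex has a non-constant type,
-- its three darts carry the three rotations of that type, and a fourth type exists unless every
-- vertex has a rotation of this same type (a, b, c); if every vertex has a constant type, then
-- by connectivity all of them agree.  In such a uniform map, weighting each dart by the product
-- of the two other face lengths at its vertex gives F·abc = V·(ab + bc + ca).  Bipartiteness
-- makes face lengths even and 3-connectivity excludes digons, so a, b, c = 2x, 2y, 2z with
-- x, y, z ≥ 2; with V = 2n and F = n + 2 this is 1/x + 1/y + 1/z = 1 + 2/n, which has no such
-- solution for odd n: either the left side is too small, or the equation forces n to be even.

open import Defs
open import Data.Bool using (Bool; T; not)
open import Data.Bool.Properties using (T?; not-involutive; not-¬; ¬-not)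
open import Data.Empty using (⊥; ⊥-elim)
open import Data.Fin using (Fin; toℕ; combine; fromℕ<) renaming (zero to f0; suc to fs)
import Data.Fin.Properties as Fin
open import Data.List
  using (List; []; _∷_; _++_; map; concatMap; length; filter; applyUpTo; upTo; allFin; cartesianProduct; lookup)
import Data.List.Properties as List
open import Data.List.Extrema.Nat using (argmin; argmin-sel; f[argmin]≤f[xs])
open import Data.List.Membership.Propositional using (_∈_; _∉_)
open import Data.List.Membership.Propositional.Properties
  using (∈-applyUpTo⁺; ∈-applyUpTo⁻; ∈-cartesianProduct⁺; ∈-allFin; ∈-filter⁺; ∈-map⁺; ∈-concat⁺′)
open import Data.List.Membership.Propositional.Properties.WithK using (unique∧set⇒bag)
open import Data.List.Relation.Binary.BagAndSetEquality using (∼bag⇒↭)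
open import Data.List.Relation.Binary.Disjoint.Propositional using (Disjoint)
open import Data.List.Relation.Binary.Permutation.Propositional using (_↭_)
import Data.List.Relation.Binary.Permutation.Propositional.Properties as Perm
open import Data.List.Relation.Unary.All as All using (All; []; _∷_)
import Data.List.Relation.Unary.All.Properties as All
open import Data.List.Relation.Unary.AllPairs using (AllPairs; []; _∷_)
import Data.List.Relation.Unary.AllPairs.Properties as AllPairs
open import Data.List.Relation.Unary.Any as Any using (here; there)
open import Data.List.Relation.Unary.Any.Properties using (lookup-index)
open import Data.List.Relation.Unary.Unique.Propositional using (Unique)
import Data.List.Relation.Unary.Unique.Propositional.Properties as Unique
open import Data.Nat
  using (ℕ; zero; suc; _+_; _*_; _∸_; _%_; _/_; _≤_; _<_; z≤n; s≤s; _<?_; NonZero; >-nonZero; ≢-nonZero⁻¹)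
open import Data.Nat.DivMod using (m≡m%n+[m/n]*n; m%n<n)
open import Data.Nat.Divisibility using (_∣_; divides; _∣0; ∣-refl; ∣m∣n⇒∣m+n)
open import Data.Nat.ListAction using (sum)
open import Data.Nat.ListAction.Properties using (sum-++; sum-↭)
open import Data.Nat.Properties
open import Data.Nat.Tactic.RingSolver using (solve-∀)
open import Data.Product using (∃; ∃-syntax; _×_; _,_; proj₁; proj₂)
open import Data.Product.Properties using (≡-dec)
open import Data.Sum using (_⊎_; inj₁; inj₂; [_,_])
open import Function using (_∘_; id; _⇔_; mk⇔; Equivalence)
open import Function.Definitions using (Injective)
open import Relation.Binary.Definitions using (tri<; tri≈; tri>)
open import Relation.Binary.PropositionalEquality
  using (_≡_; _≢_; refl; sym; trans; cong; cong₂; subst; ≢-sym; module ≡-Reasoning)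
open import Relation.Nullary using (¬_; Dec; yes; no; ¬?; _×-dec_; _⊎-dec_)
open import Relation.Nullary.Decidable using (decidable-stable)
open import Relation.Unary using (Decidable)

module _ {A : Set} (f : A → A) where

  iter-+ : ∀ j k x → iter f (j + k) x ≡ iter f j (iter f k x)
  iter-+ zero    k x = refl
  iter-+ (suc j) k x = cong f (iter-+ j k x)

  iter-*-periodic : ∀ {p x} → iter f p x ≡ x → ∀ q → iter f (q * p) x ≡ x
  iter-*-periodic         fix zero    = refl
  iter-*-periodic {p} {x} fix (suc q) = begin
    iter f (p + q * p) x        ≡⟨ iter-+ p (q * p) x ⟩
    iter f p (iter f (q * p) x) ≡⟨ cong (iter f p) (iter-*-periodic fix q) ⟩
    iter f p x                  ≡⟨ fix ⟩
    x                           ∎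
    where open ≡-Reasoning

  iter-%-periodic : ∀ {p x} .{{_ : NonZero p}} → iter f p x ≡ x → ∀ m → iter f m x ≡ iter f (m % p) x
  iter-%-periodic {p} {x} fix m = begin
    iter f m x                            ≡⟨ cong (λ k → iter f k x) (m≡m%n+[m/n]*n m p) ⟩
    iter f (m % p + m / p * p) x          ≡⟨ iter-+ (m % p) (m / p * p) x ⟩
    iter f (m % p) (iter f (m / p * p) x) ≡⟨ cong (iter f (m % p)) (iter-*-periodic fix (m / p)) ⟩
    iter f (m % p) x                      ∎
    where open ≡-Reasoning

  iter-injective : Injective _≡_ _≡_ f → ∀ k → Injective _≡_ _≡_ (iter f k)
  iter-injective f-inj zero    eq = eq
  iter-injective f-inj (suc k) eq = iter-injective f-inj k (f-inj eq)

  iter-cancel : Injective _≡_ _≡_ f → ∀ {i j x} → i ≤ j → iter f i x ≡ iter f j x → iter f (j ∸ i) x ≡ x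
  iter-cancel f-inj {i} {j} {x} i≤j same = iter-injective f-inj i (begin
    iter f i (iter f (j ∸ i) x) ≡⟨ iter-+ i (j ∸ i) x ⟨
    iter f (i + (j ∸ i)) x      ≡⟨ cong (λ k → iter f k x) (m+[n∸m]≡n i≤j) ⟩
    iter f j x                  ≡⟨ same ⟨
    iter f i x                  ∎)
    where open ≡-Reasoning

  iter-invariant : ∀ {B : Set} {g : A → B} → (∀ x → g (f x) ≡ g x) → ∀ k x → g (iter f k x) ≡ g x
  iter-invariant inv zero    x = refl
  iter-invariant inv (suc k) x = trans (inv (iter f k x)) (iter-invariant inv k x)

  iter-commute : ∀ {h : A → A} → (∀ x → h (f x) ≡ f (h x)) → ∀ k x → h (iter f k x) ≡ iter f k (h x)
  iter-commute comm zero    x = refl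
  iter-commute comm (suc k) x = trans (comm (iter f k x)) (cong f (iter-commute comm k x))

  alternating⇒even : (c : A → Bool) → (∀ x → c (f x) ≡ not (c x)) →
                     ∀ k {x} → c (iter f k x) ≡ c x → 2 ∣ k
  alternating⇒even c alt zero              _  = 2 ∣0
  alternating⇒even c alt (suc zero)    {x} eq = ⊥-elim (not-¬ refl (sym (trans (sym (alt x)) eq)))
  alternating⇒even c alt (suc (suc k)) {x} eq = ∣m∣n⇒∣m+n ∣-refl (alternating⇒even c alt k (begin
    c (iter f k x)             ≡⟨ not-involutive _ ⟨
    not (not (c (iter f k x))) ≡⟨ cong not (alt _) ⟨
    not (c (f (iter f k x)))   ≡⟨ alt _ ⟨
    c (iter f (suc (suc k)) x) ≡⟨ eq ⟩
    c x                        ∎))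
    where open ≡-Reasoning

allPairs-mapWithAll : ∀ {A : Set} {P : A → Set} {R S : A → A → Set} →
  (∀ {x y} → P x → P y → R x y → S x y) → ∀ {xs} → All P xs → AllPairs R xs → AllPairs S xs
allPairs-mapWithAll h []         []         = []
allPairs-mapWithAll h (px ∷ pxs) (rx ∷ rxs) =
  All.zipWith (λ (py , r) → h px py r) (pxs , rx) ∷ allPairs-mapWithAll h pxs rxs

sum-map-const : ∀ {A : Set} (h : A → ℕ) {c} xs → (∀ {x} → x ∈ xs → h x ≡ c) →
                sum (map h xs) ≡ length xs * c
sum-map-const h []       _     = refl
sum-map-const h (x ∷ xs) h≡c = cong₂ _+_ (h≡c (here refl)) (sum-map-const h xs (h≡c ∘ there))

sum-map-concatMap : ∀ {A B : Set} (w : B → ℕ) (g : A → List B) xs →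
                    sum (map w (concatMap g xs)) ≡ sum (map (λ x → sum (map w (g x))) xs)
sum-map-concatMap w g []       = refl
sum-map-concatMap w g (x ∷ xs) = begin
  sum (map w (g x ++ concatMap g xs))              ≡⟨ cong sum (List.map-++ w (g x) _) ⟩
  sum (map w (g x) ++ map w (concatMap g xs))      ≡⟨ sum-++ (map w (g x)) _ ⟩
  sum (map w (g x)) + sum (map w (concatMap g xs)) ≡⟨ cong (_ +_) (sum-map-concatMap w g xs) ⟩
  sum (map w (g x)) + sum (map (λ y → sum (map w (g y))) xs) ∎
  where open ≡-Reasoning

cartesianProduct-concatMap : ∀ {A B : Set} (xs : List A) (ys : List B) →
                             cartesianProduct xs ys ≡ concatMap (λ x → map (x ,_) ys) xs
cartesianProduct-concatMap []       ys = refl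
cartesianProduct-concatMap (x ∷ xs) ys = cong (map (x ,_) ys ++_) (cartesianProduct-concatMap xs ys)

module _ {n : ℕ} where
  open import Data.List.Membership.DecPropositional (Fin._≟_ {n}) using (_∈?_)

  covering-length : (xs : List (Fin n)) → (∀ z → z ∈ xs) → n ≤ length xs
  covering-length xs covers = ≮⇒≥ λ |xs|<n → collision (Fin.pigeonhole |xs|<n (Any.index ∘ covers))
    where
      open ≡-Reasoning
      collision : (∃ λ i → ∃ λ j → i Data.Fin.< j × Any.index (covers i) ≡ Any.index (covers j)) → ⊥
      collision (i , j , i<j , same) = Fin.<⇒≢ i<j (begin
        i                                ≡⟨ lookup-index (covers i) ⟩
        lookup xs (Any.index (covers i)) ≡⟨ cong (lookup xs) same ⟩
        lookup xs (Any.index (covers j)) ≡⟨ lookup-index (covers j) ⟨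
        j                                ∎)

  fresh : (xs : List (Fin n)) → length xs < n → ∃ λ z → z ∉ xs
  fresh xs |xs|<n with Fin.any? (λ z → ¬? (z ∈? xs))
  ... | yes found = found
  ... | no none = ⊥-elim (<⇒≱ |xs|<n (covering-length xs covers))
    where
      covers : ∀ z → z ∈ xs
      covers z = decidable-stable (z ∈? xs) (λ z∉xs → none (z , z∉xs))

Least : (ℕ → Set) → ℕ → Set
Least P m = P m × (∀ {k} → k < m → ¬ P k)

module _ {P : ℕ → Set} where

  least-unique : ∀ {m n} → Least P m → Least P n → m ≡ n
  least-unique {m} {n} (pm , below-m) (pn , below-n) with <-cmp m n
  ... | tri< m<n _ _ = ⊥-elim (below-n m<n pm)
  ... | tri≈ _ m≡n _ = m≡n
  ... | tri> _ _ n<m = ⊥-elim (below-m n<m pn)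

  least-≤ : ∀ {m n} → Least P m → P n → m ≤ n
  least-≤ (_ , below) pn = ≮⇒≥ (λ n<m → below n<m pn)

  least-resp : ∀ {Q : ℕ → Set} → (∀ {k} → P k ⇔ Q k) → ∀ {m} → Least P m → Least Q m
  least-resp P⇔Q (pm , below) = Equivalence.to P⇔Q pm , λ k<m → below k<m ∘ Equivalence.from P⇔Q

  least-exists : Decidable P → ∀ {n} → P n → ∃ (Least P)
  least-exists P? {n} pn = search 0 n (λ ()) (subst P (sym (+-identityʳ n)) pn)
    where
      search : ∀ i fuel → (∀ {k} → k < i → ¬ P k) → P (fuel + i) → ∃ (Least P)
      search i zero       below pᵢ = i , pᵢ , below
      search i (suc fuel) below p with P? i
      ... | yes pᵢ = i , pᵢ , below
      ... | no ¬pᵢ = search (suc i) fuel below′ (subst P (sym (+-suc fuel i)) p)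
        where
          below′ : ∀ {k} → k < suc i → ¬ P k
          below′ k<1+i with m<1+n⇒m<n∨m≡n k<1+i
          ... | inj₁ k<i  = below k<i
          ... | inj₂ refl = ¬pᵢ

Returns : {A : Set} → (A → A) → A → ℕ → Set
Returns f x k = 0 < k × iter f k x ≡ x

returns-commute : ∀ {A : Set} {f h : A → A} → Injective _≡_ _≡_ h → (∀ x → h (f x) ≡ f (h x)) →
                  ∀ {x k} → Returns f x k ⇔ Returns f (h x) k
returns-commute {f = f} {h} h-inj comm {x} {k} = mk⇔
  (λ (k>0 , fix) → k>0 , trans (sym (iter-commute f comm k x)) (cong h fix))
  (λ (k>0 , fix) → k>0 , h-inj (trans (iter-commute f comm k x) fix))

-- Orbits of a permutation of the darts

dartCode : ∀ {V} → Dart V → Fin (V * 3)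
dartCode (v , i) = combine v i

dartCode-injective : ∀ {V} → Injective _≡_ _≡_ (dartCode {V})
dartCode-injective {x = v , i} {w , j} eq with Fin.combine-injective v i w j eq
... | refl , refl = refl

dartIndex-injective : ∀ {V} → Injective _≡_ _≡_ (dartIndex {V})
dartIndex-injective {x = v , i} {w , j} eq = dartCode-injective (Fin.toℕ-injective (begin
  toℕ (combine v i) ≡⟨ Fin.toℕ-combine v i ⟩
  3 * toℕ v + toℕ i ≡⟨ eq ⟩
  3 * toℕ w + toℕ j ≡⟨ Fin.toℕ-combine w j ⟨
  toℕ (combine w j) ∎))
  where open ≡-Reasoning

_≟ᴰ_ : ∀ {V} (d e : Dart V) → Dec (d ≡ e)
_≟ᴰ_ = ≡-dec Fin._≟_ Fin._≟_

∈-allDarts : ∀ {V} (d : Dart V) → d ∈ allDarts V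
∈-allDarts (v , i) = ∈-cartesianProduct⁺ (∈-allFin v) (∈-allFin i)

allDarts-unique : ∀ {V} → Unique (allDarts V)
allDarts-unique {V} = Unique.cartesianProduct⁺ (Unique.allFin⁺ V) (Unique.allFin⁺ 3)

module Permutation {V : ℕ} (f : Dart V → Dart V) (f-injective : Injective _≡_ _≡_ f) where

  returns-within : ∀ d → ∃ λ p → Returns f d p × p ≤ 3 * V
  returns-within d with Fin.pigeonhole (n<1+n (V * 3)) (λ k → dartCode (iter f (toℕ k) d))
  ... | i , j , i<j , same = toℕ j ∸ toℕ i , (m<n⇒0<n∸m i<j , returns) , bound
    where
      returns : iter f (toℕ j ∸ toℕ i) d ≡ d
      returns = iter-cancel f f-injective (<⇒≤ i<j) (dartCode-injective same)
      bound : toℕ j ∸ toℕ i ≤ 3 * V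
      bound = ≤-trans (m∸n≤m (toℕ j) (toℕ i)) (subst (toℕ j ≤_) (*-comm V 3) (≤-pred (Fin.toℕ<n j)))

  opaque
    leastPeriod : ∀ d → ∃ (Least (Returns f d))
    leastPeriod d =
      least-exists (λ k → (0 <? k) ×-dec (iter f k d ≟ᴰ d)) (proj₁ (proj₂ (returns-within d)))

  period : Dart V → ℕ
  period d = proj₁ (leastPeriod d)

  period-returns : ∀ d → iter f (period d) d ≡ d
  period-returns d = proj₂ (proj₁ (proj₂ (leastPeriod d)))

  period-least : ∀ d {k} → 0 < k → k < period d → iter f k d ≢ d
  period-least d k>0 k<p fix = proj₂ (proj₂ (leastPeriod d)) k<p (k>0 , fix)

  instance
    period-nonZero : ∀ {d} → NonZero (period d)
    period-nonZero {d} = >-nonZero (proj₁ (proj₁ (proj₂ (leastPeriod d))))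

  period-≤ : ∀ d → period d ≤ 3 * V
  period-≤ d with returns-within d
  ... | p , returns , p≤3V = ≤-trans (least-≤ (proj₂ (leastPeriod d)) returns) p≤3V

  period-commute : ∀ {h} → Injective _≡_ _≡_ h → (∀ x → h (f x) ≡ f (h x)) →
                   ∀ d → period (h d) ≡ period d
  period-commute {h} h-inj comm d = least-unique (proj₂ (leastPeriod (h d)))
    (least-resp (returns-commute h-inj comm) (proj₂ (leastPeriod d)))

  period-f : ∀ d → period (f d) ≡ period d
  period-f = period-commute f-injective (λ _ → refl)

  orbit : Dart V → List (Dart V)
  orbit d = applyUpTo (λ k → iter f k d) (period d)

  infix 4 _↝_
  _↝_ : Dart V → Dart V → Set
  d ↝ e = ∃ λ k → iter f k d ≡ e

  ↝-trans : ∀ {d e e′} → d ↝ e → e ↝ e′ → d ↝ e′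
  ↝-trans {d} (j , refl) (k , refl) = k + j , iter-+ f k j d

  ↝-sym : ∀ {d e} → d ↝ e → e ↝ d
  ↝-sym {d} (k , refl) = k * period d ∸ k , (begin
    iter f (k * period d ∸ k) (iter f k d) ≡⟨ iter-+ f (k * period d ∸ k) k d ⟨
    iter f (k * period d ∸ k + k) d        ≡⟨ cong (λ j → iter f j d) (m∸n+n≡m (m≤m*n k (period d))) ⟩
    iter f (k * period d) d                ≡⟨ iter-*-periodic f (period-returns d) k ⟩
    d                                      ∎)
    where open ≡-Reasoning

  ↝⇒∈orbit : ∀ {d e} → d ↝ e → e ∈ orbit d
  ↝⇒∈orbit {d} (k , refl) = subst (_∈ orbit d) (sym (iter-%-periodic f (period-returns d) k))
    (∈-applyUpTo⁺ (λ j → iter f j d) (m%n<n k (period d)))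

  ∈orbit⇒↝ : ∀ {d e} → e ∈ orbit d → d ↝ e
  ∈orbit⇒↝ e∈ with ∈-applyUpTo⁻ _ e∈
  ... | k , _ , refl = k , refl

  orbit-unique : ∀ d → Unique (orbit d)
  orbit-unique d = Unique.applyUpTo⁺₁ (λ k → iter f k d) (period d) λ {i} {j} i<j j<p same →
    period-least d (m<n⇒0<n∸m i<j) (≤-<-trans (m∸n≤m j i) j<p)
      (iter-cancel f f-injective (<⇒≤ i<j) same)

  IsOrbitMin : Dart V → Set
  IsOrbitMin r = ∀ {e} → r ↝ e → dartIndex r ≤ dartIndex e

  isOrbitRep-sound : ∀ {r} → T (isOrbitRep f r) → IsOrbitMin r
  isOrbitRep-sound {r} rep r↝e with ∈-applyUpTo⁻ _ (↝⇒∈orbit r↝e)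
  ... | k , k<p , refl = ≤ᵇ⇒≤ _ _
    (All.applyUpTo⁻ _ (3 * V) (All.all⁺ _ (upTo (3 * V)) rep) (<-≤-trans k<p (period-≤ r)))

  isOrbitRep-complete : ∀ {r} → IsOrbitMin r → T (isOrbitRep f r)
  isOrbitRep-complete min = All.all⁻ _ (All.applyUpTo⁺₁ _ (3 * V) λ {k} _ → ≤⇒≤ᵇ (min (k , refl)))

  isOrbitRep-unique : ∀ {r r′ e} → T (isOrbitRep f r) → T (isOrbitRep f r′) →
                      r ↝ e → r′ ↝ e → r ≡ r′
  isOrbitRep-unique rep rep′ r↝e r′↝e = dartIndex-injective (≤-antisym
    (isOrbitRep-sound rep  (↝-trans r↝e  (↝-sym r′↝e)))
    (isOrbitRep-sound rep′ (↝-trans r′↝e (↝-sym r↝e))))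

  orbitMin : Dart V → Dart V
  orbitMin d = argmin dartIndex d (orbit d)

  ↝orbitMin : ∀ d → d ↝ orbitMin d
  ↝orbitMin d with argmin-sel dartIndex d (orbit d)
  ... | inj₁ min≡d    = 0 , sym min≡d
  ... | inj₂ min∈orbit = ∈orbit⇒↝ min∈orbit

  orbitMin-isOrbitRep : ∀ d → T (isOrbitRep f (orbitMin d))
  orbitMin-isOrbitRep d = isOrbitRep-complete λ min↝e →
    All.lookup (f[argmin]≤f[xs] d (orbit d)) (↝⇒∈orbit (↝-trans (↝orbitMin d) min↝e))

  representatives : List (Dart V)
  representatives = filter (λ d → T? (isOrbitRep f d)) (allDarts V)

  orbits-partition : concatMap orbit representatives ↭ allDarts V
  orbits-partition = ∼bag⇒↭ (unique∧set⇒bag unique allDarts-unique (mk⇔ (λ _ → ∈-allDarts _) covers))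
    where
      disjoint : ∀ {r r′} → T (isOrbitRep f r) → T (isOrbitRep f r′) →
                 r ≢ r′ → Disjoint (orbit r) (orbit r′)
      disjoint rep rep′ r≢r′ (e∈ , e∈′) =
        r≢r′ (isOrbitRep-unique rep rep′ (∈orbit⇒↝ e∈) (∈orbit⇒↝ e∈′))
      unique : Unique (concatMap orbit representatives)
      unique = Unique.concat⁺ (All.map⁺ (All.tabulate λ _ → orbit-unique _))
        (AllPairs.map⁺ (allPairs-mapWithAll disjoint (All.all-filter _ (allDarts V))
                          (Unique.filter⁺ _ allDarts-unique)))
      covers : ∀ {e} → e ∈ allDarts V → e ∈ concatMap orbit representatives
      covers {e} _ = ∈-concat⁺′ (↝⇒∈orbit (↝-sym (↝orbitMin e)))
        (∈-map⁺ orbit (∈-filter⁺ _ (∈-allDarts _) (orbitMin-isOrbitRep e)))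

  orbit-counting : ∀ (w : Dart V → ℕ) {K} → (∀ d → w (f d) ≡ w d) → (∀ d → period d * w d ≡ K) →
                   sum (map w (allDarts V)) ≡ numOrbits f * K
  orbit-counting w {K} w-invariant period*w≡K = begin
    sum (map w (allDarts V))
      ≡⟨ sum-↭ (Perm.map⁺ w orbits-partition) ⟨
    sum (map w (concatMap orbit representatives))
      ≡⟨ sum-map-concatMap w orbit representatives ⟩
    sum (map (λ r → sum (map w (orbit r))) representatives)
      ≡⟨ sum-map-const _ representatives (λ _ → orbit-sum _) ⟩
    length representatives * K
      ∎
    where
      open ≡-Reasoning
      orbit-sum : ∀ r → sum (map w (orbit r)) ≡ K
      orbit-sum r = begin
        sum (map w (orbit r))  ≡⟨ sum-map-const w (orbit r) (λ e∈ → w-on-orbit (∈orbit⇒↝ e∈)) ⟩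
        length (orbit r) * w r ≡⟨ cong (_* w r) (List.length-applyUpTo _ (period r)) ⟩
        period r * w r         ≡⟨ period*w≡K r ⟩
        K                      ∎
        where
          w-on-orbit : ∀ {e} → r ↝ e → w e ≡ w r
          w-on-orbit (k , refl) = iter-invariant f w-invariant k r

Triple : Set
Triple = ℕ × ℕ × ℕ

rotate : Triple → Triple
rotate (p , q , r) = q , r , p

rotate³ : ∀ t → rotate (rotate (rotate t)) ≡ t
rotate³ _ = refl

rotate-injective : Injective _≡_ _≡_ rotate
rotate-injective {_ , _ , _} {_ , _ , _} refl = refl

RotationOf : Triple → Triple → Set
RotationOf t s = t ≡ s ⊎ t ≡ rotate s ⊎ t ≡ rotate (rotate s)

Constant : Triple → Set
Constant t = rotate t ≡ t

_≟ᵀ_ : (t s : Triple) → Dec (t ≡ s)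
_≟ᵀ_ = ≡-dec _≟_ (≡-dec _≟_ _≟_)

rotationOf? : ∀ t s → Dec (RotationOf t s)
rotationOf? t s = (t ≟ᵀ s) ⊎-dec (t ≟ᵀ rotate s) ⊎-dec (t ≟ᵀ rotate (rotate s))

constant? : ∀ t → Dec (Constant t)
constant? t = rotate t ≟ᵀ t

rotation-invariant : ∀ {B : Set} (g : Triple → B) → (∀ t → g (rotate t) ≡ g t) →
                     ∀ {t s} → RotationOf t s → g t ≡ g s
rotation-invariant g inv (inj₁ refl)        = refl
rotation-invariant g inv (inj₂ (inj₁ refl)) = inv _
rotation-invariant g inv (inj₂ (inj₂ refl)) = trans (inv _) (inv _)

rotationOf-constant : ∀ {t s} → Constant s → RotationOf t s → t ≡ s
rotationOf-constant const (inj₁ t≡s)        = t≡s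
rotationOf-constant const (inj₂ (inj₁ t≡s)) = trans t≡s const
rotationOf-constant const (inj₂ (inj₂ t≡s)) = trans t≡s (trans (cong rotate const) const)

constant-proj₁-injective : ∀ {s t} → Constant s → Constant t → proj₁ s ≡ proj₁ t → s ≡ t
constant-proj₁-injective {_ , _ , _} {_ , _ , _} refl refl refl = refl

e₂ e₃ : Triple → ℕ
e₂ (p , q , r) = q * r + r * p + p * q
e₃ (p , q , r) = p * (q * r)

e₂-rotate : ∀ t → e₂ (rotate t) ≡ e₂ t
e₂-rotate (p , q , r) =
  trans (+-comm (r * p + p * q) (q * r)) (sym (+-assoc (q * r) (r * p) (p * q)))

e₃-rotate : ∀ t → e₃ (rotate t) ≡ e₃ t
e₃-rotate (p , q , r) = trans (sym (*-assoc q r p)) (*-comm (q * r) p)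

-- Face types of a cubic map

rot3-cover : ∀ i k → k ≡ i ⊎ k ≡ rot3 i ⊎ k ≡ rot3 (rot3 i)
rot3-cover f0           f0           = inj₁ refl
rot3-cover f0           (fs f0)      = inj₂ (inj₁ refl)
rot3-cover f0           (fs (fs f0)) = inj₂ (inj₂ refl)
rot3-cover (fs f0)      f0           = inj₂ (inj₂ refl)
rot3-cover (fs f0)      (fs f0)      = inj₁ refl
rot3-cover (fs f0)      (fs (fs f0)) = inj₂ (inj₁ refl)
rot3-cover (fs (fs f0)) f0           = inj₂ (inj₁ refl)
rot3-cover (fs (fs f0)) (fs f0)      = inj₂ (inj₂ refl)
rot3-cover (fs (fs f0)) (fs (fs f0)) = inj₁ refl

σ³ : ∀ {V} (d : Dart V) → σ (σ (σ d)) ≡ d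
σ³ (v , f0)           = refl
σ³ (v , fs f0)        = refl
σ³ (v , fs (fs f0))   = refl

σ-injective : ∀ {V} → Injective _≡_ _≡_ (σ {V})
σ-injective {x = d} {e} eq = trans (sym (σ³ d)) (trans (cong (σ ∘ σ) eq) (σ³ e))

α-injective : ∀ {V} (M : CubicMap V) → Injective _≡_ _≡_ (α M)
α-injective M {d} {e} eq = trans (sym (α-invol M d)) (trans (cong (α M) eq) (α-invol M e))

φ-injective : ∀ {V} (M : CubicMap V) → Injective _≡_ _≡_ (φ M)
φ-injective M = α-injective M ∘ σ-injective

faceLength : ∀ {V} → CubicMap V → Dart V → ℕ
faceLength M = Permutation.period (φ M) (φ-injective M)

faceType : ∀ {V} → CubicMap V → Dart V → Triple
faceType M d = faceLength M d , faceLength M (σ d) , faceLength M (σ (σ d))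

vertexType : ∀ {V} → CubicMap V → Vertex V → Triple
vertexType M v = faceType M (v , f0)

faceType-at-vertex : ∀ {V} (M : CubicMap V) v i → RotationOf (faceType M (v , i)) (vertexType M v)
faceType-at-vertex M v f0           = inj₁ refl
faceType-at-vertex M v (fs f0)      = inj₂ (inj₁ refl)
faceType-at-vertex M v (fs (fs f0)) = inj₂ (inj₂ refl)

FourFaceTypes : ∀ {V} → CubicMap V → Set
FourFaceTypes M =
  ∃[ d₀ ] ∃[ d₁ ] ∃[ d₂ ] ∃[ d₃ ]
    ( τ d₀ ≢ τ d₁ × τ d₀ ≢ τ d₂ × τ d₀ ≢ τ d₃ × τ d₁ ≢ τ d₂ × τ d₁ ≢ τ d₃ × τ d₂ ≢ τ d₃ )
  where τ = faceType M

UniformFaceType : ∀ {V} → CubicMap V → Set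
UniformFaceType {V} M = ∃ λ v → ∀ (d : Dart V) → RotationOf (faceType M d) (vertexType M v)

module _ {V} (M : CubicMap V) where
  open Permutation (φ M) (φ-injective M) using (period-commute)

  faceType-automorphism : (A : Automorphism M) →
                          ∀ d → faceType M (Automorphism.g A d) ≡ faceType M d
  faceType-automorphism A d = cong₂ _,_ (length-g d) (cong₂ _,_
    (trans (cong (faceLength M) (sym (comm-σ d))) (length-g (σ d)))
    (trans (cong (faceLength M) (sym g-σ²)) (length-g (σ (σ d)))))
    where
      open Automorphism A
      g-σ² : g (σ (σ d)) ≡ σ (σ (g d))
      g-σ² = trans (comm-σ (σ d)) (cong σ (comm-σ d))
      length-g : ∀ d → faceLength M (g d) ≡ faceLength M d
      length-g = period-commute (λ {x} {y} eq → trans (sym (inv₂ x)) (trans (cong g⁻¹ eq) (inv₂ y)))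
                                (λ d → trans (comm-σ (α M d)) (cong σ (comm-α d)))

  faceType-sameRooting : ∀ {d e} → SameRooting M d e → faceType M d ≡ faceType M e
  faceType-sameRooting {d} (A , refl) = sym (faceType-automorphism A d)

  fourFaceTypes⇒atLeastFourRootings : FourFaceTypes M → AtLeastFourRootings M
  fourFaceTypes⇒atLeastFourRootings (d₀ , d₁ , d₂ , d₃ , τ₀₁ , τ₀₂ , τ₀₃ , τ₁₂ , τ₁₃ , τ₂₃) =
    d₀ , d₁ , d₂ , d₃ ,
    distinct τ₀₁ , distinct τ₀₂ , distinct τ₀₃ , distinct τ₁₂ , distinct τ₁₃ , distinct τ₂₃
    where
      distinct : ∀ {d e} → faceType M d ≢ faceType M e → ¬ SameRooting M d e
      distinct τ≢ = τ≢ ∘ faceType-sameRooting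

module _ {V} (M : CubicMap V) where
  open Permutation (φ M) (φ-injective M) using (period-f)

  reach-vertexType : (∀ v → Constant (vertexType M v)) →
                     ∀ {P u w} → Reach M P u w → vertexType M u ≡ vertexType M w
  reach-vertexType constant (here _) = refl
  reach-vertexType constant (step {u} {w} _ (k , l , αuk≡wl) reach) =
    trans (constant-proj₁-injective (constant u) (constant w) shared-face) (reach-vertexType constant reach)
    where
      open ≡-Reasoning
      constant-at : ∀ v i → faceLength M (v , i) ≡ faceLength M (v , f0)
      constant-at v i = cong proj₁ (rotationOf-constant (constant v) (faceType-at-vertex M v i))
      shared-face : faceLength M (u , f0) ≡ faceLength M (w , f0)
      shared-face = begin
        faceLength M (u , f0)          ≡⟨ constant-at u k ⟨
        faceLength M (u , k)           ≡⟨ period-f (u , k) ⟨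
        faceLength M (σ (α M (u , k))) ≡⟨ cong (faceLength M ∘ σ) αuk≡wl ⟩
        faceLength M (σ (w , l))       ≡⟨ constant-at w (rot3 l) ⟩
        faceLength M (w , f0)          ∎

  fourFaceTypes-around : ∀ v → ¬ Constant (vertexType M v) → FourFaceTypes M ⊎ UniformFaceType M
  fourFaceTypes-around v moving
    with Fin.any? (λ w → Fin.any? (λ i → ¬? (rotationOf? (faceType M (w , i)) (vertexType M v))))
  ... | yes (w , i , outside) =
    inj₁ ((v , f0) , (v , fs f0) , (v , fs (fs f0)) , (w , i) ,
          τ₀₁ , τ₀₂ , outside ∘ inj₁ ∘ sym , τ₀₁ ∘ rotate-injective ,
          outside ∘ inj₂ ∘ inj₁ ∘ sym , outside ∘ inj₂ ∘ inj₂ ∘ sym)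
    where
      t = vertexType M v
      τ₀₁ : t ≢ rotate t
      τ₀₁ = moving ∘ sym
      τ₀₂ : t ≢ rotate (rotate t)
      τ₀₂ t≡r²t = moving (trans (cong rotate t≡r²t) (rotate³ t))
  ... | no none-outside =
    inj₂ (v , λ (w , i) → decidable-stable (rotationOf? _ _) (λ outside → none-outside (w , i , outside)))

  fourFaceTypes-or-uniform : Connected M → Vertex V → FourFaceTypes M ⊎ UniformFaceType M
  fourFaceTypes-or-uniform connected v₀ with Fin.any? (λ v → ¬? (constant? (vertexType M v)))
  ... | yes (v , moving) = fourFaceTypes-around v moving
  ... | no none-moving = inj₂ (v₀ , λ (w , i) → inj₁ (trans
          (rotationOf-constant (constant w) (faceType-at-vertex M w i))
          (reach-vertexType constant (connected w v₀))))
    where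
      constant : ∀ v → Constant (vertexType M v)
      constant v = decidable-stable (constant? (vertexType M v)) (λ moving → none-moving (v , moving))

-- 3-connectivity

module _ {V} (M : CubicMap V) where

  reach-start : ∀ {P u w} → Reach M P u w → P u
  reach-start (here pu)     = pu
  reach-start (step pu _ _) = pu

  reach-closed : ∀ {P S : Vertex V → Set} → (∀ {s t} → S s → Adjacent M s t → P t → S t) →
                 ∀ {u w} → Reach M P u w → S u → S w
  reach-closed closed (here _)           su = su
  reach-closed closed (step _ adj reach) su =
    reach-closed closed reach (closed su adj (reach-start reach))

  cut-by-two : ThreeConnected M → (S : Vertex V → Set) (a b : Vertex V) →
               (∀ {s t} → S s → Adjacent M s t → S t ⊎ t ≡ a ⊎ t ≡ b) →
               ∀ {u z} → S u → ¬ S z → u ≢ a → u ≢ b → z ≢ a → z ≢ b → ⊥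
  cut-by-two (_ , _ , separated) S a b exits {u} {z} su ¬sz u≢a u≢b z≢a z≢b =
    ¬sz (reach-closed closed (separated a b u z u≢a u≢b z≢a z≢b) su)
    where
      closed : ∀ {s t} → S s → Adjacent M s t → t ≢ a × t ≢ b → S t
      closed ss adj (t≢a , t≢b) with exits ss adj
      ... | inj₁ st          = st
      ... | inj₂ (inj₁ t≡a) = ⊥-elim (t≢a t≡a)
      ... | inj₂ (inj₂ t≡b) = ⊥-elim (t≢b t≡b)

  adjacent-distinct : Bipartite M → ∀ {u w} → Adjacent M u w → u ≢ w
  adjacent-distinct (_ , proper) adj refl = proper _ _ adj refl

  -- The digon u w is joined to the rest only through the third neighbours x of u and y of w,
  -- so {x, y} would separate it from a fifth vertex z; when y = u, already x does.
  no-digon : Bipartite M → ThreeConnected M → 5 ≤ V → ∀ d → iter (φ M) 2 d ≢ d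
  no-digon bip tc 5≤V (u , i) φ²d≡d = separate (fresh (u ∷ w ∷ x ∷ y ∷ []) 5≤V) (y Fin.≟ u)
    where
      w = proj₁ (α M (u , i))
      j = proj₂ (α M (u , i))
      x = proj₁ (α M (u , rot3 i))
      y = proj₁ (α M (w , rot3 (rot3 j)))

      back : α M (w , rot3 j) ≡ (u , rot3 (rot3 i))
      back = trans (sym (σ³ _)) (cong (σ ∘ σ) φ²d≡d)

      S : Vertex V → Set
      S t = t ≡ u ⊎ t ≡ w

      exits : ∀ {s t} → S s → Adjacent M s t → S t ⊎ t ≡ x ⊎ t ≡ y
      exits (inj₁ refl) (k , l , αsk≡tl) with rot3-cover i k
      ... | inj₁ refl        = inj₁ (inj₂ (cong proj₁ (sym αsk≡tl)))
      ... | inj₂ (inj₁ refl) = inj₂ (inj₁ (cong proj₁ (sym αsk≡tl)))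
      ... | inj₂ (inj₂ refl) =
        inj₁ (inj₂ (cong proj₁ (trans (sym αsk≡tl) (trans (cong (α M) (sym back)) (α-invol M _)))))
      exits (inj₂ refl) (k , l , αsk≡tl) with rot3-cover j k
      ... | inj₁ refl        = inj₁ (inj₁ (cong proj₁ (trans (sym αsk≡tl) (α-invol M (u , i)))))
      ... | inj₂ (inj₁ refl) = inj₁ (inj₁ (cong proj₁ (trans (sym αsk≡tl) back)))
      ... | inj₂ (inj₂ refl) = inj₂ (inj₂ (cong proj₁ (sym αsk≡tl)))

      u≢x : u ≢ x
      u≢x = adjacent-distinct bip (rot3 i , proj₂ (α M (u , rot3 i)) , refl)

      separate : (∃ λ z → z ∉ u ∷ w ∷ x ∷ y ∷ []) → Dec (y ≡ u) → ⊥
      separate (z , z∉) (no y≢u) =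
        cut-by-two tc S x y exits (inj₁ refl) [ z∉ ∘ here , z∉ ∘ there ∘ here ]
          u≢x (≢-sym y≢u) (z∉ ∘ there ∘ there ∘ here) (z∉ ∘ there ∘ there ∘ there ∘ here)
      separate (z , z∉) (yes y≡u) =
        cut-by-two tc S x x exits-x (inj₁ refl) [ z∉ ∘ here , z∉ ∘ there ∘ here ]
          u≢x u≢x (z∉ ∘ there ∘ there ∘ here) (z∉ ∘ there ∘ there ∘ here)
        where
          exits-x : ∀ {s t} → S s → Adjacent M s t → S t ⊎ t ≡ x ⊎ t ≡ x
          exits-x ss adj with exits ss adj
          ... | inj₁ st          = inj₁ st
          ... | inj₂ (inj₁ t≡x) = inj₂ (inj₁ t≡x)
          ... | inj₂ (inj₂ t≡y) = inj₁ (inj₁ (trans t≡y y≡u))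

-- Face lengths and face counting

module _ {V} (M : CubicMap V) where
  open Permutation (φ M) (φ-injective M) using (period-nonZero; period-returns; period-f; orbit-counting)

  faceLength-even : Bipartite M → ∀ d → 2 ∣ faceLength M d
  faceLength-even (colour , proper) d = alternating⇒even (φ M) (colour ∘ proj₁) alternates
    (faceLength M d) (cong (colour ∘ proj₁) (period-returns d))
    where
      alternates : ∀ d → colour (proj₁ (φ M d)) ≡ not (colour (proj₁ d))
      alternates (v , i) = ¬-not (≢-sym (proper v _ (i , proj₂ (α M (v , i)) , refl)))

  faceLength-≥4 : Bipartite M → ThreeConnected M → 5 ≤ V →
                  ∀ d → ∃ λ q → faceLength M d ≡ q * 2 × 2 ≤ q
  faceLength-≥4 bip tc 5≤V d with faceLength-even bip d
  ... | divides zero          len≡0 = ⊥-elim (≢-nonZero⁻¹ (faceLength M d) len≡0)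
  ... | divides (suc zero)    len≡2 =
    ⊥-elim (no-digon M bip tc 5≤V d (subst (λ k → iter (φ M) k d ≡ d) len≡2 (period-returns d)))
  ... | divides (suc (suc q)) len≡  = suc (suc q) , len≡ , s≤s (s≤s z≤n)

  uniform-count : ∀ {s} → (∀ d → RotationOf (faceType M d) s) → numFaces M * e₃ s ≡ V * e₂ s
  uniform-count {s} uniform = begin
    numFaces M * e₃ s
      ≡⟨ orbit-counting w w-invariant e₃≡ ⟨
    sum (map w (allDarts V))
      ≡⟨ cong (sum ∘ map w) (cartesianProduct-concatMap (allFin V) (allFin 3)) ⟩
    sum (map w (concatMap (λ v → map (v ,_) (allFin 3)) (allFin V)))
      ≡⟨ sum-map-concatMap w _ (allFin V) ⟩
    sum (map (λ v → sum (map w (map (v ,_) (allFin 3)))) (allFin V))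
      ≡⟨ sum-map-const _ (allFin V) (λ _ → vertex-sum _) ⟩
    length (allFin V) * e₂ s
      ≡⟨ cong (_* e₂ s) (List.length-tabulate {n = V} id) ⟩
    V * e₂ s
      ∎
    where
      open ≡-Reasoning
      w : Dart V → ℕ
      w d = faceLength M (σ d) * faceLength M (σ (σ d))

      e₃≡ : ∀ d → faceLength M d * w d ≡ e₃ s
      e₃≡ d = rotation-invariant e₃ e₃-rotate (uniform d)

      w-invariant : ∀ d → w (φ M d) ≡ w d
      w-invariant d = *-cancelˡ-≡ (w (φ M d)) (w d) (faceLength M (φ M d)) (begin
        faceLength M (φ M d) * w (φ M d) ≡⟨ e₃≡ (φ M d) ⟩
        e₃ s                             ≡⟨ e₃≡ d ⟨
        faceLength M d * w d             ≡⟨ cong (_* w d) (period-f d) ⟨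
        faceLength M (φ M d) * w d       ∎)

      vertex-sum : ∀ v → w (v , f0) + (w (v , fs f0) + (w (v , fs (fs f0)) + 0)) ≡ e₂ s
      vertex-sum v = begin
        a + (b + (c + 0))   ≡⟨ cong (λ k → a + (b + k)) (+-identityʳ c) ⟩
        a + (b + c)         ≡⟨ +-assoc a b c ⟨
        e₂ (vertexType M v) ≡⟨ rotation-invariant e₂ e₂-rotate (uniform (v , f0)) ⟩
        e₂ s                ∎
        where a = w (v , f0); b = w (v , fs f0); c = w (v , fs (fs f0))

-- The face equation

-- 1/x + 1/y + 1/z = 1 + 2/n, cleared of denominators
FaceEquation : ℕ → ℕ → ℕ → ℕ → Set
FaceEquation n x y z = (n + 2) * e₃ (x , y , z) ≡ n * e₂ (x , y , z)

faceEquation-swap₁₂ : ∀ n x y z → FaceEquation n x y z → FaceEquation n y x z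
faceEquation-swap₁₂ n x y z eq = trans (lhs n x y z) (trans eq (rhs n x y z))
  where
    lhs : ∀ n x y z → (n + 2) * (y * (x * z)) ≡ (n + 2) * (x * (y * z))
    lhs = solve-∀
    rhs : ∀ n x y z → n * (y * z + z * x + x * y) ≡ n * (x * z + z * y + y * x)
    rhs = solve-∀

faceEquation-swap₂₃ : ∀ n x y z → FaceEquation n x y z → FaceEquation n x z y
faceEquation-swap₂₃ n x y z eq = trans (lhs n x y z) (trans eq (rhs n x y z))
  where
    lhs : ∀ n x y z → (n + 2) * (x * (z * y)) ≡ (n + 2) * (x * (y * z))
    lhs = solve-∀
    rhs : ∀ n x y z → n * (y * z + z * x + x * y) ≡ n * (z * y + y * x + x * z)
    rhs = solve-∀

overshoots : ∀ {L R k} → L ≡ R + suc k → L ≢ R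
overshoots L≡R+1+k L≡R = m+1+n≢m _ (trans (sym L≡R+1+k) L≡R)

parity-clash : ∀ {L R} C K .{{_ : NonZero K}} p q →
               L ≡ C + K * (2 * p) → R ≡ C + K * (1 + 2 * q) → L ≢ R
parity-clash C K p q L≡ R≡ L≡R =
  even≢odd p q (*-cancelˡ-≡ _ _ K (+-cancelˡ-≡ C _ _ (trans (sym L≡) (trans L≡R R≡))))

faceEquation-3-3-3 : ∀ n a b c → ¬ FaceEquation n (3 + a) (3 + b) (3 + c)
faceEquation-3-3-3 n a b c = overshoots (excess n a b c)
  where
    excess : ∀ n a b c →
      (n + 2) * ((3 + a) * ((3 + b) * (3 + c))) ≡
      n * ((3 + b) * (3 + c) + (3 + c) * (3 + a) + (3 + a) * (3 + b)) +
      suc (53 + 18 * (a + b + c) + 6 * (a * b + b * c + c * a) + 2 * (a * b * c) +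
           n * (3 * (a + b + c) + 2 * (a * b + b * c + c * a) + a * b * c))
    excess = solve-∀

faceEquation-2-4-4 : ∀ n b c → ¬ FaceEquation n 2 (4 + b) (4 + c)
faceEquation-2-4-4 n b c = overshoots (excess n b c)
  where
    excess : ∀ n b c →
      (n + 2) * (2 * ((4 + b) * (4 + c))) ≡
      n * ((4 + b) * (4 + c) + (4 + c) * 2 + 2 * (4 + b)) +
      suc (63 + 16 * b + 16 * c + 4 * (b * c) + n * (b * c + 2 * b + 2 * c))
    excess = solve-∀

faceEquation-2-3-6 : ∀ n c → ¬ FaceEquation n 2 3 (6 + c)
faceEquation-2-3-6 n c = overshoots (excess n c)
  where
    excess : ∀ n c →
      (n + 2) * (2 * (3 * (6 + c))) ≡ n * (3 * (6 + c) + (6 + c) * 2 + 2 * 3) + suc (71 + 12 * c + n * c)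
    excess = solve-∀

faceEquation-2-2 : ∀ t z → ¬ FaceEquation (1 + 2 * t) 2 2 z
faceEquation-2-2 t z = parity-clash (4 * z + 8 * (t * z)) 4 z t (lhs t z) (rhs t z)
  where
    lhs : ∀ t z → (1 + 2 * t + 2) * (2 * (2 * z)) ≡ 4 * z + 8 * (t * z) + 4 * (2 * z)
    lhs = solve-∀
    rhs : ∀ t z → (1 + 2 * t) * (2 * z + z * 2 + 2 * 2) ≡ 4 * z + 8 * (t * z) + 4 * (1 + 2 * t)
    rhs = solve-∀

faceEquation-2-3-3 : ∀ t → ¬ FaceEquation (1 + 2 * t) 2 3 3
faceEquation-2-3-3 t = parity-clash 0 1 (27 + 18 * t) (10 + 21 * t) (lhs t) (rhs t)
  where
    lhs : ∀ t → (1 + 2 * t + 2) * (2 * (3 * 3)) ≡ 0 + 1 * (2 * (27 + 18 * t))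
    lhs = solve-∀
    rhs : ∀ t → (1 + 2 * t) * (3 * 3 + 3 * 2 + 2 * 3) ≡ 0 + 1 * (1 + 2 * (10 + 21 * t))
    rhs = solve-∀

faceEquation-2-3-4 : ∀ t → ¬ FaceEquation (1 + 2 * t) 2 3 4
faceEquation-2-3-4 t = ≢-sym (parity-clash (26 + 48 * t) 2 t 11 (rhs t) (lhs t))
  where
    lhs : ∀ t → (1 + 2 * t + 2) * (2 * (3 * 4)) ≡ 26 + 48 * t + 2 * (1 + 2 * 11)
    lhs = solve-∀
    rhs : ∀ t → (1 + 2 * t) * (3 * 4 + 4 * 2 + 2 * 3) ≡ 26 + 48 * t + 2 * (2 * t)
    rhs = solve-∀

faceEquation-2-3-5 : ∀ t → ¬ FaceEquation (1 + 2 * t) 2 3 5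
faceEquation-2-3-5 t = parity-clash 0 1 (45 + 30 * t) (15 + 31 * t) (lhs t) (rhs t)
  where
    lhs : ∀ t → (1 + 2 * t + 2) * (2 * (3 * 5)) ≡ 0 + 1 * (2 * (45 + 30 * t))
    lhs = solve-∀
    rhs : ∀ t → (1 + 2 * t) * (3 * 5 + 5 * 2 + 2 * 3) ≡ 0 + 1 * (1 + 2 * (15 + 31 * t))
    rhs = solve-∀

faceEquation-2-3 : ∀ t c → ¬ FaceEquation (1 + 2 * t) 2 3 (3 + c)
faceEquation-2-3 t 0                   = faceEquation-2-3-3 t
faceEquation-2-3 t 1                   = faceEquation-2-3-4 t
faceEquation-2-3 t 2                   = faceEquation-2-3-5 t
faceEquation-2-3 t (suc (suc (suc c))) = faceEquation-2-3-6 (1 + 2 * t) c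

faceEquation-2 : ∀ t b c → ¬ FaceEquation (1 + 2 * t) 2 (2 + b) (2 + c)
faceEquation-2 t zero          c             = faceEquation-2-2 t (2 + c)
faceEquation-2 t (suc b)       zero          = faceEquation-2-2 t (3 + b) ∘ faceEquation-swap₂₃ (1 + 2 * t) 2 (3 + b) 2
faceEquation-2 t 1             (suc c)       = faceEquation-2-3 t c
faceEquation-2 t (suc (suc b)) 1             = faceEquation-2-3 t (1 + b) ∘ faceEquation-swap₂₃ (1 + 2 * t) 2 (4 + b) 3
faceEquation-2 t (suc (suc b)) (suc (suc c)) = faceEquation-2-4-4 (1 + 2 * t) b c

-- Up to symmetry x = 2, as x, y, z ≥ 3 makes (n + 2)xyz too large, and likewise y = 2, or y = 3
-- and z ≤ 5; in these remaining cases the equation forces n to be even.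
faceEquation-odd : ∀ t a b c → ¬ FaceEquation (1 + 2 * t) (2 + a) (2 + b) (2 + c)
faceEquation-odd t zero    b       c       = faceEquation-2 t b c
faceEquation-odd t (suc a) zero    c       = faceEquation-2 t (suc a) c ∘ faceEquation-swap₁₂ (1 + 2 * t) (3 + a) 2 (2 + c)
faceEquation-odd t (suc a) (suc b) zero    = faceEquation-2 t (suc a) (suc b) ∘ faceEquation-swap₁₂ (1 + 2 * t) (3 + a) 2 (3 + b)
                                               ∘ faceEquation-swap₂₃ (1 + 2 * t) (3 + a) (3 + b) 2
faceEquation-odd t (suc a) (suc b) (suc c) = faceEquation-3-3-3 (1 + 2 * t) a b c

faceEquation-unsolvable : ∀ n {x y z} → n % 2 ≡ 1 → 2 ≤ x → 2 ≤ y → 2 ≤ z → ¬ FaceEquation n x y z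
faceEquation-unsolvable n odd (s≤s (s≤s {n = a} _)) (s≤s (s≤s {n = b} _)) (s≤s (s≤s {n = c} _)) =
  subst (λ m → ¬ FaceEquation m (2 + a) (2 + b) (2 + c)) (sym n≡1+2t) (faceEquation-odd (n / 2) a b c)
  where
    n≡1+2t : n ≡ 1 + 2 * (n / 2)
    n≡1+2t = trans (m≡m%n+[m/n]*n n 2) (cong₂ _+_ odd (*-comm (n / 2) 2))

faceEquation-halve : ∀ n x y z →
  (n + 2) * e₃ (x * 2 , y * 2 , z * 2) ≡ 2 * n * e₂ (x * 2 , y * 2 , z * 2) → FaceEquation n x y z
faceEquation-halve n x y z eq = *-cancelˡ-≡ _ _ 8 (trans (sym (lhs n x y z)) (trans eq (rhs n x y z)))
  where
    lhs : ∀ n x y z → (n + 2) * (x * 2 * (y * 2 * (z * 2))) ≡ 8 * ((n + 2) * (x * (y * z)))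
    lhs = solve-∀
    rhs : ∀ n x y z → 2 * n * (y * 2 * (z * 2) + z * 2 * (x * 2) + x * 2 * (y * 2)) ≡
                      8 * (n * (y * z + z * x + x * y))
    rhs = solve-∀

-- Planar bicubic maps

planar-numFaces : ∀ n (M : CubicMap (2 * n)) → Planar M → numFaces M ≡ n + 2
planar-numFaces n M planar =
  *-cancelˡ-≡ _ _ 2 (+-cancelˡ-≡ (2 * (2 * n)) _ _ (trans planar (euler n)))
  where
    euler : ∀ n → 3 * (2 * n) + 4 ≡ 2 * (2 * n) + 2 * (n + 2)
    euler = solve-∀

uniform-impossible : ∀ n (M : CubicMap (2 * n)) → n % 2 ≡ 1 → 5 ≤ 2 * n →
                     Bipartite M → Planar M → ThreeConnected M → ¬ UniformFaceType M
uniform-impossible n M odd 5≤V bip planar tc (v , uniform)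
  with faceLength-≥4 M bip tc 5≤V (v , f0)
     | faceLength-≥4 M bip tc 5≤V (v , fs f0)
     | faceLength-≥4 M bip tc 5≤V (v , fs (fs f0))
... | x , a≡2x , 2≤x | y , b≡2y , 2≤y | z , c≡2z , 2≤z =
  faceEquation-unsolvable n odd 2≤x 2≤y 2≤z (faceEquation-halve n x y z (begin
    (n + 2) * e₃ (x * 2 , y * 2 , z * 2) ≡⟨ cong₂ (λ F t → F * e₃ t) (planar-numFaces n M planar) lengths ⟨
    numFaces M * e₃ (vertexType M v)     ≡⟨ uniform-count M uniform ⟩
    2 * n * e₂ (vertexType M v)          ≡⟨ cong (λ t → 2 * n * e₂ t) lengths ⟩
    2 * n * e₂ (x * 2 , y * 2 , z * 2)   ∎))
  where
    open ≡-Reasoning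
    lengths : vertexType M v ≡ (x * 2 , y * 2 , z * 2)
    lengths = cong₂ _,_ a≡2x (cong₂ _,_ b≡2y c≡2z)

corollary4p5 : (n : ℕ) → 7 ≤ n → n % 2 ≡ 1 →
    (M : CubicMap (2 * n)) → Bipartite M → Planar M → ThreeConnected M →
    AtLeastFourRootings M
corollary4p5 n 7≤n odd M bip planar tc@(_ , connected , _) =
  [ fourFaceTypes⇒atLeastFourRootings M
  , ⊥-elim ∘ uniform-impossible n M odd 5≤2n bip planar tc
  ] (fourFaceTypes-or-uniform M connected (fromℕ< (<-≤-trans (s≤s z≤n) 5≤2n)))
  where
    5≤2n : 5 ≤ 2 * n
    5≤2n = ≤-trans (m≤m+n 5 2) (≤-trans 7≤n (m≤n*m n 2))
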